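{- Conditional bisimilarity and conditional environment congruence coincide: ${\simeq_C}={\simeq_E}$.
   Context: Composition of $f\colon A\to B$, $g\colon B\to C$ is written $f;g$. Fix a category $\mathbf C$ with distinguished object $0$ and a representative class $\kappa$ of commuting squares: for every commuting square $\alpha_1;\delta_1=\alpha_2;\delta_2$ there are $(\alpha_1,\alpha_2,\beta_1,\beta_2)\in\kappa$ (a commuting square) and $\gamma$ with $\delta_1=\beta_1;\gamma$, $\delta_2=\beta_2;\gamma$; $\kappa(\alpha_1,\alpha_2)$ is the set of $(\beta_1,\beta_2)$ with $(\alpha_1,\alpha_2,\beta_1,\beta_2)\in\kappa$. Conditions over $A$ are defined inductively as $(A,\mathcal Q,S)$, $\mathcal Q\in\{\forall,\exists\}$, $S$ a finite set of pairs $(h,\mathcal A')$ with $h\colon A\to A'$, $\mathcal A'$ a condition over $A'$. For $a\colon A\to B$: $a\models(A,\forall,S)$ iff for all $(h,\mathcal A')\in S$ and all $g$ with $a=h;g$, $g\models\mathcal A'$; $a\models(A,\exists,S)$ iff some $(h,\mathcal A')\in S$ and $g$ satisfy $a=h;g$, $g\models\mathcal A'$. $\mathcal A\models\mathcal B$: every arrow satisfying $\mathcal A$ satisfies $\mathcal B$. Boolean connectives have the standard semantics. Shift along $c\colon A\to B$: $(A,\mathcal Q,S)_{\downarrow c}=(B,\mathcal Q,\{(\beta,\mathcal A'_{\downarrow\alpha})\mid(h,\mathcal A')\in S,(\alpha,\beta)\in\kappa(h,c)\})$; it satisfies $c;d\models\mathcal A\iff d\models\mathcal A_{\downarrow c}$.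 A conditional reactive system is a set $\mathcal S$ of rules $(\ell,r,\mathcal R)$, $\ell,r\colon0\to I$, $\mathcal R$ a condition over $I$. Context step $a\xrightarrow[C]{f,\ \mathcal A}a'$ ($a\colon0\to J$, $f\colon J\to K$, $a'\colon0\to K$, $\mathcal A$ over $K$): there are a rule $(\ell,r,\mathcal R)\in\mathcal S$ and $c\colon I\to K$ with $a;f=\ell;c$, $a'=r;c$, $\mathcal A\models\mathcal R_{\downarrow c}$. Environment step $a\xrightarrow[E]{d}a'$ ($a,a'\colon0\to K$, $d\colon K\to J$): there are a rule $(\ell,r,\mathcal R)\in\mathcal S$ and $c$ with $a=\ell;c$, $a'=r;c$ and $c;d\models\mathcal R$. A conditional relation is a set of triples $(a,b,\mathcal C)$, $a,b\colon0\to J$, $\mathcal C$ a condition over $J$. $\mathcal D\models\bigvee_{i\in I}\mathcal E_i$ (possibly infinite $I$): every arrow satisfying $\mathcal D$ satisfies some $\mathcal E_i$. A conditional bisimulation is a conditional relation $R$ such that for each $(a,b,\mathcal C)\in R$ and each context step $a\xrightarrow[C]{f,\ \mathcal A}a'$ there are a (possibly infinite) index set $I$, context steps $b\xrightarrow[C]{f,\ \mathcal B_i}b'_i$ and conditions $\mathcal C'_i$ with $(a',b'_i,\mathcal C'_i)\in R$ and $\mathcal A\land\mathcal C_{\downarrow f}\models\bigvee_{i\in I}(\mathcal C'_i\land\mathcal B_i)$, and symmetrically for context steps of $b$; $\simeq_C$ is the set of triples contained in some conditional bisimulation. A conditional relation $R$ is a conditional congruence if it is reflexive ($(a,a,\mathcal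 C)\in R$ whenever $\mathcal C$ is a condition over the codomain of $a$), symmetric, transitive ($(a,b,\mathcal C),(b,c,\mathcal C)\in R$ implies $(a,c,\mathcal C)\in R$) and closed under contextualization ($(a,b,\mathcal C)\in R$ implies $(a;d,b;d,\mathcal C_{\downarrow d})\in R$). $R$ is a conditional environment bisimulation if whenever $(a,b,\mathcal C)\in R$ and $a\xrightarrow[E]{d}a'$ for some $d\models\mathcal C$, there are $b'$ with $b\xrightarrow[E]{d}b'$ and a condition $\mathcal C'$ with $d\models\mathcal C'$ and $(a',b',\mathcal C')\in R$; and symmetrically for environment steps of $b$. The conditional environment congruence $\simeq_E$ is the largest conditional environment bisimulation that is also a conditional congruence. -}

module Defs where

open import Level using (Level; _⊔_; suc)
open import Data.Product using (Σ; _×_; _,_; ∃; ∃-syntax)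
open import Data.Sum using (_⊎_)
open import Data.List using (List; []; _∷_; _++_)
open import Data.List.Membership.Propositional using (_∈_)
open import Data.Unit.Polymorphic using (⊤)
open import Data.Empty.Polymorphic using (⊥)
open import Relation.Binary.PropositionalEquality using (_≡_)

-- Categories (diagrammatic composition f ⨾ g = "f;g"), arrows compared by ≡

record Cat (o h : Level) : Set (suc (o ⊔ h)) where
  infixl 9 _⨾_
  field
    Obj   : Set o
    Hom   : Obj → Obj → Set h
    id    : ∀ {A} → Hom A A
    _⨾_   : ∀ {A B C} → Hom A B → Hom B C → Hom A C
    idˡ   : ∀ {A B} (f : Hom A B) → id ⨾ f ≡ f
    idʳ   : ∀ {A B} (f : Hom A B) → f ⨾ id ≡ f
    assoc : ∀ {A B C D} (f : Hom A B) (g : Hom B C) (k : Hom C D) →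
            (f ⨾ g) ⨾ k ≡ f ⨾ (g ⨾ k)

-- A representative class κ of commuting squares.
-- kappa α₁ α₂ lists the (finitely many) pairs (β₁ , β₂) with
-- (α₁ , α₂ , β₁ , β₂) ∈ κ (finiteness is needed so that shifting yields
-- conditions with finite branch sets).

module _ {o h} (𝐂 : Cat o h) where
  open Cat 𝐂

  Cospan : ∀ {B₁ B₂} → Set (o ⊔ h)
  Cospan {B₁} {B₂} = Σ Obj λ D → Hom B₁ D × Hom B₂ D

  record RepSquares : Set (o ⊔ h) where
    field
      kappa     : ∀ {A B₁ B₂} → Hom A B₁ → Hom A B₂ → List (Cospan {B₁} {B₂})
      commutes  : ∀ {A B₁ B₂ D} (α₁ : Hom A B₁) (α₂ : Hom A B₂)
                    (β₁ : Hom B₁ D) (β₂ : Hom B₂ D) →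
                  (D , β₁ , β₂) ∈ kappa α₁ α₂ → α₁ ⨾ β₁ ≡ α₂ ⨾ β₂
      represent : ∀ {A B₁ B₂ E} (α₁ : Hom A B₁) (α₂ : Hom A B₂)
                    (δ₁ : Hom B₁ E) (δ₂ : Hom B₂ E) →
                  α₁ ⨾ δ₁ ≡ α₂ ⨾ δ₂ →
                  Σ Obj λ D → Σ (Hom B₁ D) λ β₁ → Σ (Hom B₂ D) λ β₂ →
                  Σ (Hom D E) λ γ →
                    ((D , β₁ , β₂) ∈ kappa α₁ α₂) × (δ₁ ≡ β₁ ⨾ γ) × (δ₂ ≡ β₂ ⨾ γ)

data Quant : Set where
  ∀Q ∃Q : Quant

module Conditions {o h} (𝐂 : Cat o h) where
  open Cat 𝐂

  data Cond : Obj → Set (o ⊔ h) where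
    cond : ∀ {A} → Quant → List (Σ Obj λ A' → Hom A A' × Cond A') → Cond A

  Branches : Obj → Set (o ⊔ h)
  Branches A = List (Σ Obj λ A' → Hom A A' × Cond A')

  infix 4 _⊨_
  mutual
    _⊨_ : ∀ {A B} → Hom A B → Cond A → Set (o ⊔ h)
    a ⊨ cond ∀Q S = ⊨All a S
    a ⊨ cond ∃Q S = ⊨Any a S

    ⊨All : ∀ {A B} → Hom A B → Branches A → Set (o ⊔ h)
    ⊨All a [] = ⊤
    ⊨All {B = B} a ((A' , k , 𝒜') ∷ S) =
      (∀ (g : Hom A' B) → a ≡ k ⨾ g → g ⊨ 𝒜') × ⊨All a S

    ⊨Any : ∀ {A B} → Hom A B → Branches A → Set (o ⊔ h)
    ⊨Any a [] = ⊥
    ⊨Any {B = B} a ((A' , k , 𝒜') ∷ S) =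
      (Σ (Hom A' B) λ g → (a ≡ k ⨾ g) × (g ⊨ 𝒜')) ⊎ ⊨Any a S

  infix 4 _⊫_
  _⊫_ : ∀ {A} → Cond A → Cond A → Set (o ⊔ h)
  _⊫_ {A} 𝒜 ℬ = ∀ {B} (a : Hom A B) → a ⊨ 𝒜 → a ⊨ ℬ

module Shift {o h} (𝐂 : Cat o h) (κ : RepSquares 𝐂) where
  open Cat 𝐂
  open Conditions 𝐂
  open RepSquares κ

  mutual
    _↓_ : ∀ {A B} → Cond A → Hom A B → Cond B
    cond Q S ↓ c = cond Q (shiftBranches S c)

    shiftBranches : ∀ {A B} → Branches A → Hom A B → Branches B
    shiftBranches [] c = []
    shiftBranches ((A' , k , 𝒜') ∷ S) c =
      shiftOne 𝒜' (kappa k c) ++ shiftBranches S c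

    shiftOne : ∀ {A' B} → Cond A' → List (Cospan 𝐂 {A'} {B}) → Branches B
    shiftOne 𝒜' [] = []
    shiftOne 𝒜' ((D , α , β) ∷ ks) = (D , β , 𝒜' ↓ α) ∷ shiftOne 𝒜' ks

module Reactive {o h} (𝐂 : Cat o h) (κ : RepSquares 𝐂) (𝟎 : Cat.Obj 𝐂) where
  open Cat 𝐂
  open Conditions 𝐂
  open Shift 𝐂 κ

  record Rule : Set (o ⊔ h) where
    constructor rule
    field
      I : Obj
      ℓ : Hom 𝟎 I
      r : Hom 𝟎 I
      ℛ : Cond I

  System : Set (suc (o ⊔ h))
  System = Rule → Set (o ⊔ h)

  module Steps (𝒮 : System) where

    CStep : ∀ {J K} → Hom 𝟎 J → Hom J K → Cond K → Hom 𝟎 K → Set (o ⊔ h)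
    CStep {J} {K} a f 𝒜 a' =
      Σ Rule λ ρ → 𝒮 ρ × (let open Rule ρ in
        Σ (Hom I K) λ c → (a ⨾ f ≡ ℓ ⨾ c) × (a' ≡ r ⨾ c) × (𝒜 ⊫ ℛ ↓ c))

    EStep : ∀ {K J} → Hom 𝟎 K → Hom K J → Hom 𝟎 K → Set (o ⊔ h)
    EStep {K} {J} a d a' =
      Σ Rule λ ρ → 𝒮 ρ × (let open Rule ρ in
        Σ (Hom I K) λ c → (a ≡ ℓ ⨾ c) × (a' ≡ r ⨾ c) × ((c ⨾ d) ⊨ ℛ))

    CRel : (p : Level) → Set (o ⊔ h ⊔ suc p)
    CRel p = ∀ {J} → Hom 𝟎 J → Hom 𝟎 J → Cond J → Set p

    _⊆_ : ∀ {p q} → CRel p → CRel q → Set (o ⊔ h ⊔ p ⊔ q)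
    R ⊆ R' = ∀ {J} (a b : Hom 𝟎 J) (𝒞 : Cond J) → R a b 𝒞 → R' a b 𝒞

    Transfer : ∀ {p} → CRel p → Set (suc (o ⊔ h) ⊔ p)
    Transfer R =
      ∀ {J K} (a b : Hom 𝟎 J) (𝒞 : Cond J) → R a b 𝒞 →
      (f : Hom J K) (𝒜 : Cond K) (a' : Hom 𝟎 K) → CStep a f 𝒜 a' →
      Σ (Set (o ⊔ h)) λ Ix →
      Σ (Ix → Hom 𝟎 K) λ b' → Σ (Ix → Cond K) λ ℬ → Σ (Ix → Cond K) λ 𝒞' →
        (∀ i → CStep b f (ℬ i) (b' i)) ×
        (∀ i → R a' (b' i) (𝒞' i)) ×
        (∀ {X} (x : Hom K X) → x ⊨ 𝒜 → x ⊨ (𝒞 ↓ f) →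
           Σ Ix λ i → (x ⊨ 𝒞' i) × (x ⊨ ℬ i))

    Flip : ∀ {p} → CRel p → CRel p
    Flip R a b 𝒞 = R b a 𝒞

    IsCondBisim : ∀ {p} → CRel p → Set (suc (o ⊔ h) ⊔ p)
    IsCondBisim R = Transfer R × Transfer (Flip R)

    ≃C : CRel (suc (o ⊔ h))
    ≃C a b 𝒞 = Σ (CRel (o ⊔ h)) λ R → IsCondBisim R × R a b 𝒞

    record IsCondCongruence {p} (R : CRel p) : Set (o ⊔ h ⊔ p) where
      field
        refl  : ∀ {J} (a : Hom 𝟎 J) (𝒞 : Cond J) → R a a 𝒞
        sym   : ∀ {J} (a b : Hom 𝟎 J) (𝒞 : Cond J) → R a b 𝒞 → R b a 𝒞
        trans : ∀ {J} (a b c : Hom 𝟎 J) (𝒞 : Cond J) →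
                R a b 𝒞 → R b c 𝒞 → R a c 𝒞
        ctx   : ∀ {J K} (a b : Hom 𝟎 J) (𝒞 : Cond J) (d : Hom J K) →
                R a b 𝒞 → R (a ⨾ d) (b ⨾ d) (𝒞 ↓ d)

    EnvTransfer : ∀ {p} → CRel p → Set (o ⊔ h ⊔ p)
    EnvTransfer R =
      ∀ {K J} (a b : Hom 𝟎 K) (𝒞 : Cond K) → R a b 𝒞 →
      (d : Hom K J) → d ⊨ 𝒞 → (a' : Hom 𝟎 K) → EStep a d a' →
      Σ (Hom 𝟎 K) λ b' → EStep b d b' ×
      Σ (Cond K) λ 𝒞' → (d ⊨ 𝒞') × R a' b' 𝒞'

    IsEnvBisim : ∀ {p} → CRel p → Set (o ⊔ h ⊔ p)
    IsEnvBisim R = EnvTransfer R × EnvTransfer (Flip R)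

    -- R is the largest conditional environment bisimulation that is also a
    -- conditional congruence (i.e. R is ≃_E)
    IsLargestEnvCongruence : ∀ {p} → CRel p → Set (suc (o ⊔ h) ⊔ p)
    IsLargestEnvCongruence R =
      (IsEnvBisim R × IsCondCongruence R) ×
      (∀ (R' : CRel (o ⊔ h)) → IsEnvBisim R' → IsCondCongruence R' → R' ⊆ R)

module Submission where

-- The transfer property of a conditional bisimulation asks for a
-- covering family of answers; it is equivalent to a POINTWISE property: every
-- arrow x satisfying 𝒜 ∧ 𝒞↓f is matched by one answering step of b (the family
-- is then indexed by all such witnesses x, as in the paper).  With this
-- reformulation:
--   * conditional bisimulations contain the identity and are closed under
--     flipping, relational composition and contextualisation, so ≃C (their
--     union) is a conditional congruence;
--   * a context step with label (f , 𝒜) fired in an environment x ⊨ 𝒜 is the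
--     same as an environment step of a ⨾ f along x, hence every conditional
--     bisimulation is an environment bisimulation, and conversely every
--     context-closed environment bisimulation is a conditional bisimulation.
-- The last two facts make ≃C an environment congruence containing all others.

open import Defs
open import Level using (_⊔_; Lift; lift; lower)
open import Data.Product using (Σ; _×_; _,_; proj₁; proj₂; swap)
open import Data.Sum using (_⊎_; inj₁; inj₂)
open import Data.List using (List; []; _∷_; _++_)
open import Data.List.Membership.Propositional using (_∈_)
open import Data.List.Relation.Unary.Any using (here; there)
open import Data.Unit.Polymorphic using (tt)
open import Relation.Binary.PropositionalEquality using (_≡_; refl; sym; trans; cong; subst; module ≡-Reasoning)

module Satisfaction {o h} (𝐂 : Cat o h) where
  open Cat 𝐂
  open Conditions 𝐂

  ⊨All-++⁻ : ∀ {A B} {a : Hom A B} (xs : Branches A) {ys : Branches A} →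
             ⊨All a (xs ++ ys) → ⊨All a xs × ⊨All a ys
  ⊨All-++⁻ [] p = tt , p
  ⊨All-++⁻ (_ ∷ xs) (p , ps) with ⊨All-++⁻ xs ps
  ... | pxs , pys = (p , pxs) , pys

  ⊨All-++⁺ : ∀ {A B} {a : Hom A B} (xs : Branches A) {ys : Branches A} →
             ⊨All a xs → ⊨All a ys → ⊨All a (xs ++ ys)
  ⊨All-++⁺ [] _ q = q
  ⊨All-++⁺ (_ ∷ xs) (p , ps) q = p , ⊨All-++⁺ xs ps q

  ⊨Any-++⁻ : ∀ {A B} {a : Hom A B} (xs : Branches A) {ys : Branches A} →
             ⊨Any a (xs ++ ys) → ⊨Any a xs ⊎ ⊨Any a ys
  ⊨Any-++⁻ [] p = inj₂ p
  ⊨Any-++⁻ (_ ∷ xs) (inj₁ p) = inj₁ (inj₁ p)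
  ⊨Any-++⁻ (_ ∷ xs) (inj₂ p) with ⊨Any-++⁻ xs p
  ... | inj₁ q = inj₁ (inj₂ q)
  ... | inj₂ q = inj₂ q

  ⊨Any-++⁺ˡ : ∀ {A B} {a : Hom A B} (xs : Branches A) {ys : Branches A} →
              ⊨Any a xs → ⊨Any a (xs ++ ys)
  ⊨Any-++⁺ˡ (_ ∷ xs) (inj₁ p) = inj₁ p
  ⊨Any-++⁺ˡ (_ ∷ xs) (inj₂ p) = inj₂ (⊨Any-++⁺ˡ xs p)

  ⊨Any-++⁺ʳ : ∀ {A B} {a : Hom A B} (xs : Branches A) {ys : Branches A} →
              ⊨Any a ys → ⊨Any a (xs ++ ys)
  ⊨Any-++⁺ʳ [] p = p
  ⊨Any-++⁺ʳ (_ ∷ xs) p = inj₂ (⊨Any-++⁺ʳ xs p)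

  -- Conjunction: a universal condition with two identity branches.  It is
  -- needed to combine the conditions produced when composing bisimulations.
  infixr 6 _∧_
  _∧_ : ∀ {A} → Cond A → Cond A → Cond A
  𝒜 ∧ ℬ = cond ∀Q ((_ , id , 𝒜) ∷ (_ , id , ℬ) ∷ [])

  ∧-intro : ∀ {A X} {𝒜 ℬ : Cond A} {x : Hom A X} → x ⊨ 𝒜 → x ⊨ ℬ → x ⊨ 𝒜 ∧ ℬ
  ∧-intro {𝒜 = 𝒜} {ℬ} x⊨𝒜 x⊨ℬ =
    (λ g x≡g → subst (_⊨ 𝒜) (trans x≡g (idˡ g)) x⊨𝒜) ,
    (λ g x≡g → subst (_⊨ ℬ) (trans x≡g (idˡ g)) x⊨ℬ) , tt

  ∧-elimˡ : ∀ {A} {𝒜 ℬ : Cond A} → 𝒜 ∧ ℬ ⊫ 𝒜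
  ∧-elimˡ x (x⊨𝒜 , _) = x⊨𝒜 x (sym (idˡ x))

  ∧-elimʳ : ∀ {A} {𝒜 ℬ : Cond A} → 𝒜 ∧ ℬ ⊫ ℬ
  ∧-elimʳ x (_ , x⊨ℬ , _) = x⊨ℬ x (sym (idˡ x))

-- Semantics of the shift: c ⨾ d ⊨ 𝒜 ⇔ d ⊨ 𝒜↓c, and its consequences.
module ShiftLaws {o h} (𝐂 : Cat o h) (κ : RepSquares 𝐂) where
  open Cat 𝐂
  open RepSquares κ
  open Conditions 𝐂
  open Shift 𝐂 κ
  open Satisfaction 𝐂

  square-factor : ∀ {A A' B D X} (k : Hom A A') (c : Hom A B) (α : Hom A' D)
                  (β : Hom B D) (g' : Hom D X) (d : Hom B X) →
                  k ⨾ α ≡ c ⨾ β → d ≡ β ⨾ g' → c ⨾ d ≡ k ⨾ (α ⨾ g')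
  square-factor k c α β g' d square d≡ = begin
    c ⨾ d           ≡⟨ cong (c ⨾_) d≡ ⟩
    c ⨾ (β ⨾ g')    ≡⟨ sym (assoc c β g') ⟩
    (c ⨾ β) ⨾ g'    ≡⟨ cong (_⨾ g') (sym square) ⟩
    (k ⨾ α) ⨾ g'    ≡⟨ assoc k α g' ⟩
    k ⨾ (α ⨾ g')    ∎
    where open ≡-Reasoning

  mutual
    shift-sound : ∀ {A B X} (𝒜 : Cond A) (c : Hom A B) (d : Hom B X) →
                  d ⊨ 𝒜 ↓ c → c ⨾ d ⊨ 𝒜
    shift-sound (cond ∀Q S) c d p = shift-sound-∀ S c d p
    shift-sound (cond ∃Q S) c d p = shift-sound-∃ S c d p

    -- A factorisation c ⨾ d = k ⨾ g is represented by a κ-square through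
    -- which d factors; the shifted branch for that square yields g ⊨ 𝒜'.
    shift-sound-∀ : ∀ {A B X} (S : Branches A) (c : Hom A B) (d : Hom B X) →
                    ⊨All d (shiftBranches S c) → ⊨All (c ⨾ d) S
    shift-sound-∀ [] c d _ = tt
    shift-sound-∀ ((_ , k , 𝒜') ∷ S) c d p with ⊨All-++⁻ (shiftOne 𝒜' (kappa k c)) p
    ... | p-k , p-S = sound-k , shift-sound-∀ S c d p-S
      where
      sound-k : ∀ g → c ⨾ d ≡ k ⨾ g → g ⊨ 𝒜'
      sound-k g c⨾d≡k⨾g with represent k c g d (sym c⨾d≡k⨾g)
      ... | _ , _ , _ , γ , square∈κ , g≡ , d≡ =
        subst (_⊨ 𝒜') (sym g≡) (shift-sound-∀-one 𝒜' (kappa k c) d p-k square∈κ γ d≡)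

    shift-sound-∀-one : ∀ {A' B X} (𝒜' : Cond A') (ks : List (Cospan 𝐂 {A'} {B}))
                        (d : Hom B X) → ⊨All d (shiftOne 𝒜' ks) →
                        ∀ {D α β} → (D , α , β) ∈ ks →
                        (g' : Hom D X) → d ≡ β ⨾ g' → α ⨾ g' ⊨ 𝒜'
    shift-sound-∀-one 𝒜' (_ ∷ ks) d (p , _) (here refl) g' d≡ = shift-sound 𝒜' _ g' (p g' d≡)
    shift-sound-∀-one 𝒜' (_ ∷ ks) d (_ , ps) (there m) g' d≡ = shift-sound-∀-one 𝒜' ks d ps m g' d≡

    shift-sound-∃ : ∀ {A B X} (S : Branches A) (c : Hom A B) (d : Hom B X) →
                    ⊨Any d (shiftBranches S c) → ⊨Any (c ⨾ d) S
    shift-sound-∃ ((_ , k , 𝒜') ∷ S) c d p with ⊨Any-++⁻ (shiftOne 𝒜' (kappa k c)) p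
    ... | inj₂ p-S = inj₂ (shift-sound-∃ S c d p-S)
    ... | inj₁ p-k with shift-sound-∃-one 𝒜' (kappa k c) d p-k
    ... | _ , α , β , square∈κ , g' , d≡ , α⨾g'⊨𝒜' =
      inj₁ (α ⨾ g' , square-factor k c α β g' d (commutes k c α β square∈κ) d≡ , α⨾g'⊨𝒜')

    shift-sound-∃-one : ∀ {A' B X} (𝒜' : Cond A') (ks : List (Cospan 𝐂 {A'} {B}))
                        (d : Hom B X) → ⊨Any d (shiftOne 𝒜' ks) →
                        Σ Obj λ D → Σ (Hom A' D) λ α → Σ (Hom B D) λ β → ((D , α , β) ∈ ks) ×
                        Σ (Hom D X) λ g' → (d ≡ β ⨾ g') × (α ⨾ g' ⊨ 𝒜')
    shift-sound-∃-one 𝒜' ((D , α , β) ∷ ks) d (inj₁ (g' , d≡ , p)) =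
      D , α , β , here refl , g' , d≡ , shift-sound 𝒜' α g' p
    shift-sound-∃-one 𝒜' (_ ∷ ks) d (inj₂ p) with shift-sound-∃-one 𝒜' ks d p
    ... | D , α , β , m , g' , d≡ , q = D , α , β , there m , g' , d≡ , q

  mutual
    shift-complete : ∀ {A B X} (𝒜 : Cond A) (c : Hom A B) (d : Hom B X) →
                     c ⨾ d ⊨ 𝒜 → d ⊨ 𝒜 ↓ c
    shift-complete (cond ∀Q S) c d p = shift-complete-∀ S c d p
    shift-complete (cond ∃Q S) c d p = shift-complete-∃ S c d p

    shift-complete-∀ : ∀ {A B X} (S : Branches A) (c : Hom A B) (d : Hom B X) →
                       ⊨All (c ⨾ d) S → ⊨All d (shiftBranches S c)
    shift-complete-∀ [] c d _ = tt
    shift-complete-∀ ((_ , k , 𝒜') ∷ S) c d (p-k , p-S) =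
      ⊨All-++⁺ (shiftOne 𝒜' (kappa k c))
        (shift-complete-∀-one 𝒜' (kappa k c) d λ {_} {α} {β} square∈κ g' d≡ →
           p-k (α ⨾ g') (square-factor k c α β g' d (commutes k c α β square∈κ) d≡))
        (shift-complete-∀ S c d p-S)

    shift-complete-∀-one : ∀ {A' B X} (𝒜' : Cond A') (ks : List (Cospan 𝐂 {A'} {B}))
                           (d : Hom B X) →
                           (∀ {D α β} → (D , α , β) ∈ ks →
                             (g' : Hom D X) → d ≡ β ⨾ g' → α ⨾ g' ⊨ 𝒜') →
                           ⊨All d (shiftOne 𝒜' ks)
    shift-complete-∀-one 𝒜' [] d _ = tt
    shift-complete-∀-one 𝒜' ((_ , α , _) ∷ ks) d H =
      (λ g' d≡ → shift-complete 𝒜' α g' (H (here refl) g' d≡)) ,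
      shift-complete-∀-one 𝒜' ks d (λ m → H (there m))

    -- A witness g of c ⨾ d = k ⨾ g is represented by a κ-square through
    -- which d factors; the corresponding shifted branch is then satisfied.
    shift-complete-∃ : ∀ {A B X} (S : Branches A) (c : Hom A B) (d : Hom B X) →
                       ⊨Any (c ⨾ d) S → ⊨Any d (shiftBranches S c)
    shift-complete-∃ ((_ , k , 𝒜') ∷ S) c d (inj₁ (g , c⨾d≡k⨾g , g⊨𝒜'))
      with represent k c g d (sym c⨾d≡k⨾g)
    ... | _ , _ , _ , γ , square∈κ , g≡ , d≡ =
      ⊨Any-++⁺ˡ (shiftOne 𝒜' (kappa k c))
        (shift-complete-∃-one 𝒜' (kappa k c) d square∈κ γ d≡ (subst (_⊨ 𝒜') g≡ g⊨𝒜'))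
    shift-complete-∃ ((_ , k , 𝒜') ∷ S) c d (inj₂ p-S) =
      ⊨Any-++⁺ʳ (shiftOne 𝒜' (kappa k c)) (shift-complete-∃ S c d p-S)

    shift-complete-∃-one : ∀ {A' B X} (𝒜' : Cond A') (ks : List (Cospan 𝐂 {A'} {B}))
                           (d : Hom B X) → ∀ {D α β} → (D , α , β) ∈ ks →
                           (g' : Hom D X) → d ≡ β ⨾ g' → α ⨾ g' ⊨ 𝒜' →
                           ⊨Any d (shiftOne 𝒜' ks)
    shift-complete-∃-one 𝒜' (_ ∷ ks) d (here refl) g' d≡ p =
      inj₁ (g' , d≡ , shift-complete 𝒜' _ g' p)
    shift-complete-∃-one 𝒜' (_ ∷ ks) d (there m) g' d≡ p =
      inj₂ (shift-complete-∃-one 𝒜' ks d m g' d≡ p)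

  shift-mono : ∀ {A K} {𝒜 ℬ : Cond A} → 𝒜 ⊫ ℬ → (f : Hom A K) → 𝒜 ↓ f ⊫ ℬ ↓ f
  shift-mono {𝒜 = 𝒜} {ℬ} 𝒜⊫ℬ f x p = shift-complete ℬ f x (𝒜⊫ℬ (f ⨾ x) (shift-sound 𝒜 f x p))

  shift-id : ∀ {A} (𝒜 : Cond A) → 𝒜 ⊫ 𝒜 ↓ id
  shift-id 𝒜 x p = shift-complete 𝒜 id x (subst (_⊨ 𝒜) (sym (idˡ x)) p)

  shift-⨾ : ∀ {A B C} (𝒜 : Cond A) (c : Hom A B) (d : Hom B C) → (𝒜 ↓ c) ↓ d ⊫ 𝒜 ↓ (c ⨾ d)
  shift-⨾ 𝒜 c d x p =
    shift-complete 𝒜 (c ⨾ d) x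
      (subst (_⊨ 𝒜) (sym (assoc c d x)) (shift-sound 𝒜 c (d ⨾ x) (shift-sound (𝒜 ↓ c) d x p)))

module CondBisimulation {o h} (𝐂 : Cat o h) (κ : RepSquares 𝐂) (𝟎 : Cat.Obj 𝐂)
                        (𝒮 : Reactive.System 𝐂 κ 𝟎) where
  open Cat 𝐂
  open Conditions 𝐂
  open Shift 𝐂 κ
  open Reactive 𝐂 κ 𝟎
  open Steps 𝒮
  open Satisfaction 𝐂
  open ShiftLaws 𝐂 κ

  retarget : ∀ {J J₀ K} {a : Hom 𝟎 J} {f : Hom J K} {a₀ : Hom 𝟎 J₀} {f₀ : Hom J₀ K}
               {𝒜 : Cond K} {a' : Hom 𝟎 K} →
             a ⨾ f ≡ a₀ ⨾ f₀ → CStep a f 𝒜 a' → CStep a₀ f₀ 𝒜 a'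
  retarget a⨾f≡ (ρ , ρ∈𝒮 , c , lhs , rhs , 𝒜⊫ℛ↓c) =
    ρ , ρ∈𝒮 , c , trans (sym a⨾f≡) lhs , rhs , 𝒜⊫ℛ↓c

  ctx⇒env : ∀ {J K X} {a : Hom 𝟎 J} {f : Hom J K} {𝒜 : Cond K} {a' : Hom 𝟎 K}
              {x : Hom K X} → CStep a f 𝒜 a' → x ⊨ 𝒜 → EStep (a ⨾ f) x a'
  ctx⇒env {x = x} (ρ , ρ∈𝒮 , c , lhs , rhs , 𝒜⊫ℛ↓c) x⊨𝒜 =
    ρ , ρ∈𝒮 , c , lhs , rhs , shift-sound (Rule.ℛ ρ) c x (𝒜⊫ℛ↓c x x⊨𝒜)

  env⇒ctx : ∀ {J K X} {a : Hom 𝟎 J} {f : Hom J K} {a' : Hom 𝟎 K} {x : Hom K X} →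
            EStep (a ⨾ f) x a' → Σ (Cond K) λ 𝒜 → CStep a f 𝒜 a' × x ⊨ 𝒜
  env⇒ctx {x = x} (ρ , ρ∈𝒮 , c , lhs , rhs , c⨾x⊨ℛ) =
    Rule.ℛ ρ ↓ c , (ρ , ρ∈𝒮 , c , lhs , rhs , λ _ p → p) , shift-complete (Rule.ℛ ρ) c x c⨾x⊨ℛ

  record Match {p} (R : CRel p) {J K X} (b : Hom 𝟎 J) (f : Hom J K) (a' : Hom 𝟎 K)
               (x : Hom K X) : Set (o ⊔ h ⊔ p) where
    constructor match
    field
      target  : Hom 𝟎 K
      guard   : Cond K
      post    : Cond K
      step    : CStep b f guard target
      related : R a' target post
      ⊨post   : x ⊨ post
      ⊨guard  : x ⊨ guard

  Simulates : ∀ {p} → CRel p → Set (o ⊔ h ⊔ p)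
  Simulates R = ∀ {J K X} (a b : Hom 𝟎 J) (𝒞 : Cond J) → R a b 𝒞 →
                (f : Hom J K) (𝒜 : Cond K) (a' : Hom 𝟎 K) → CStep a f 𝒜 a' →
                (x : Hom K X) → x ⊨ 𝒜 → x ⊨ 𝒞 ↓ f → Match R b f a' x

  transfer⇒simulates : ∀ {p} {R : CRel p} → Transfer R → Simulates R
  transfer⇒simulates T a b 𝒞 r f 𝒜 a' st x x⊨𝒜 x⊨𝒞↓f with T a b 𝒞 r f 𝒜 a' st
  ... | _ , b' , ℬ , 𝒞' , steps , related , covers with covers x x⊨𝒜 x⊨𝒞↓f
  ... | i , x⊨𝒞' , x⊨ℬ = match (b' i) (ℬ i) (𝒞' i) (steps i) (related i) x⊨𝒞' x⊨ℬ

  -- ... and conversely, indexing the answers by all witnesses x.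
  simulates⇒transfer : ∀ {p} {R : CRel p} → Simulates R → Transfer R
  simulates⇒transfer {R = R} sim {K = K} a b 𝒞 r f 𝒜 a' st =
    Witness , (λ w → target (answer w)) , (λ w → guard (answer w)) , (λ w → post (answer w)) ,
    (λ w → step (answer w)) , (λ w → related (answer w)) ,
    λ x x⊨𝒜 x⊨𝒞↓f → let w = (_ , x , x⊨𝒜 , x⊨𝒞↓f) in w , ⊨post (answer w) , ⊨guard (answer w)
    where
    open Match
    Witness : Set (o ⊔ h)
    Witness = Σ Obj λ X → Σ (Hom K X) λ x → (x ⊨ 𝒜) × (x ⊨ 𝒞 ↓ f)
    answer : (w : Witness) → Match R b f a' (proj₁ (proj₂ w))
    answer (_ , x , x⊨𝒜 , x⊨𝒞↓f) = sim a b 𝒞 r f 𝒜 a' st x x⊨𝒜 x⊨𝒞↓f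

  simulates-resp : ∀ {p q} {R : CRel p} {S : CRel q} → S ⊆ R → R ⊆ S → Simulates R → Simulates S
  simulates-resp S⊆R R⊆S sim a b 𝒞 s f 𝒜 a' st x x⊨𝒜 x⊨𝒞↓f =
    let match b' ℬ 𝒞' b-step r' x⊨𝒞' x⊨ℬ = sim a b 𝒞 (S⊆R a b 𝒞 s) f 𝒜 a' st x x⊨𝒜 x⊨𝒞↓f
    in match b' ℬ 𝒞' b-step (R⊆S a' b' 𝒞' r') x⊨𝒞' x⊨ℬ

  -- A relation between equal states that contains the diagonal simulates:
  -- b answers with a's own step.
  diagonal-simulates : ∀ {p} {R : CRel p} →
                       (∀ {J} (a b : Hom 𝟎 J) (𝒞 : Cond J) → R a b 𝒞 → a ≡ b) →
                       (∀ {J} (a : Hom 𝟎 J) (𝒞 : Cond J) → R a a 𝒞) → Simulates R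
  diagonal-simulates R⇒≡ R-diag a b 𝒞 r f 𝒜 a' st x x⊨𝒜 x⊨𝒞↓f =
    match a' 𝒜 (𝒞 ↓ f) (retarget {𝒜 = 𝒜} (cong (_⨾ f) (R⇒≡ a b 𝒞 r)) st) (R-diag a' (𝒞 ↓ f)) x⊨𝒞↓f x⊨𝒜

  -- The identity relation (lifted to the level of ≃C's witnesses).
  Identity : CRel (o ⊔ h)
  Identity a b _ = Lift o (a ≡ b)

  Comp : ∀ {p q} → CRel p → CRel q → CRel (o ⊔ h ⊔ p ⊔ q)
  Comp R₁ R₂ {J} a c 𝒞 = Σ (Hom 𝟎 J) λ b → Σ (Cond J) λ 𝒞₁ → Σ (Cond J) λ 𝒞₂ →
                         R₁ a b 𝒞₁ × R₂ b c 𝒞₂ × 𝒞 ⊫ 𝒞₁ × 𝒞 ⊫ 𝒞₂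

  -- Composition of simulations: b's answer is a step that c answers in turn.
  comp-simulates : ∀ {p q} {R₁ : CRel p} {R₂ : CRel q} →
                   Simulates R₁ → Simulates R₂ → Simulates (Comp R₁ R₂)
  comp-simulates sim₁ sim₂ a c 𝒞 (b , 𝒞₁ , 𝒞₂ , r₁ , r₂ , 𝒞⊫𝒞₁ , 𝒞⊫𝒞₂) f 𝒜 a' st x x⊨𝒜 x⊨𝒞↓f =
    let match b' ℬ 𝒞₁' b-step r₁' x⊨𝒞₁' x⊨ℬ =
          sim₁ a b 𝒞₁ r₁ f 𝒜 a' st x x⊨𝒜 (shift-mono {𝒜 = 𝒞} {𝒞₁} 𝒞⊫𝒞₁ f x x⊨𝒞↓f)
        match c' 𝒟 𝒞₂' c-step r₂' x⊨𝒞₂' x⊨𝒟 =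
          sim₂ b c 𝒞₂ r₂ f ℬ b' b-step x x⊨ℬ (shift-mono {𝒜 = 𝒞} {𝒞₂} 𝒞⊫𝒞₂ f x x⊨𝒞↓f)
    in match c' 𝒟 (𝒞₁' ∧ 𝒞₂') c-step
         (b' , 𝒞₁' , 𝒞₂' , r₁' , r₂' , ∧-elimˡ {𝒜 = 𝒞₁'} {𝒞₂'} , ∧-elimʳ {𝒜 = 𝒞₁'} {𝒞₂'})
         (∧-intro {𝒜 = 𝒞₁'} {𝒞₂'} x⊨𝒞₁' x⊨𝒞₂') x⊨𝒟

  flip-comp⁺ : ∀ {p q} {R₁ : CRel p} {R₂ : CRel q} → Flip (Comp R₁ R₂) ⊆ Comp (Flip R₂) (Flip R₁)
  flip-comp⁺ _ _ _ (b , 𝒞₁ , 𝒞₂ , r₁ , r₂ , e₁ , e₂) = b , 𝒞₂ , 𝒞₁ , r₂ , r₁ , e₂ , e₁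

  flip-comp⁻ : ∀ {p q} {R₁ : CRel p} {R₂ : CRel q} → Comp (Flip R₂) (Flip R₁) ⊆ Flip (Comp R₁ R₂)
  flip-comp⁻ _ _ _ (b , 𝒞₂ , 𝒞₁ , r₂ , r₁ , e₂ , e₁) = b , 𝒞₁ , 𝒞₂ , r₁ , r₂ , e₁ , e₂

  Ctx : ∀ {p} → CRel p → CRel (o ⊔ h ⊔ p)
  Ctx R {J} a b 𝒞 = Σ Obj λ J₀ → Σ (Hom J₀ J) λ d → Σ (Hom 𝟎 J₀) λ a₀ → Σ (Hom 𝟎 J₀) λ b₀ →
                    Σ (Cond J₀) λ 𝒞₀ → R a₀ b₀ 𝒞₀ × a ≡ a₀ ⨾ d × b ≡ b₀ ⨾ d × 𝒞 ⊫ 𝒞₀ ↓ d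

  ctx-embed : ∀ {p} {R : CRel p} → R ⊆ Ctx R
  ctx-embed a b 𝒞 r = _ , id , a , b , 𝒞 , r , sym (idʳ a) , sym (idʳ b) , shift-id 𝒞

  in-context : ∀ {J₀ J K} {a : Hom 𝟎 J} {a₀ : Hom 𝟎 J₀} {d : Hom J₀ J} (f : Hom J K) →
               a ≡ a₀ ⨾ d → a ⨾ f ≡ a₀ ⨾ (d ⨾ f)
  in-context f a≡ = trans (cong (_⨾ f) a≡) (assoc _ _ f)

  ctx-simulates : ∀ {p} {R : CRel p} → Simulates R → Simulates (Ctx R)
  ctx-simulates sim a b 𝒞 (_ , d , a₀ , b₀ , 𝒞₀ , r , a≡ , b≡ , 𝒞⊫𝒞₀↓d) f 𝒜 a' st x x⊨𝒜 x⊨𝒞↓f =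
    let x⊨𝒞₀↓d⨾f = shift-⨾ 𝒞₀ d f x (shift-mono {𝒜 = 𝒞} {𝒞₀ ↓ d} 𝒞⊫𝒞₀↓d f x x⊨𝒞↓f)
        match b' ℬ 𝒞' b₀-step r' x⊨𝒞' x⊨ℬ =
          sim a₀ b₀ 𝒞₀ r (d ⨾ f) 𝒜 a' (retarget {𝒜 = 𝒜} (in-context f a≡) st) x x⊨𝒜 x⊨𝒞₀↓d⨾f
    in match b' ℬ 𝒞' (retarget {𝒜 = ℬ} (sym (in-context f b≡)) b₀-step) (ctx-embed a' b' 𝒞' r') x⊨𝒞' x⊨ℬ

  flip-ctx⁺ : ∀ {p} {R : CRel p} → Flip (Ctx R) ⊆ Ctx (Flip R)
  flip-ctx⁺ _ _ _ (J₀ , d , a₀ , b₀ , 𝒞₀ , r , a≡ , b≡ , e) = J₀ , d , b₀ , a₀ , 𝒞₀ , r , b≡ , a≡ , e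

  flip-ctx⁻ : ∀ {p} {R : CRel p} → Ctx (Flip R) ⊆ Flip (Ctx R)
  flip-ctx⁻ _ _ _ (J₀ , d , a₀ , b₀ , 𝒞₀ , r , a≡ , b≡ , e) = J₀ , d , b₀ , a₀ , 𝒞₀ , r , b≡ , a≡ , e

  identity-bisim : IsCondBisim Identity
  identity-bisim =
    simulates⇒transfer (diagonal-simulates (λ _ _ _ → lower) (λ _ _ → lift refl)) ,
    simulates⇒transfer (diagonal-simulates (λ _ _ _ r → sym (lower r)) (λ _ _ → lift refl))

  flip-bisim : ∀ {p} {R : CRel p} → IsCondBisim R → IsCondBisim (Flip R)
  flip-bisim = swap

  comp-bisim : ∀ {p q} {R₁ : CRel p} {R₂ : CRel q} →
               IsCondBisim R₁ → IsCondBisim R₂ → IsCondBisim (Comp R₁ R₂)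
  comp-bisim {R₁ = R₁} {R₂} (T₁ , T₁ᶠ) (T₂ , T₂ᶠ) =
    simulates⇒transfer (comp-simulates (transfer⇒simulates T₁) (transfer⇒simulates T₂)) ,
    simulates⇒transfer
      (simulates-resp (flip-comp⁺ {R₁ = R₁} {R₂}) (flip-comp⁻ {R₁ = R₁} {R₂})
        (comp-simulates (transfer⇒simulates T₂ᶠ) (transfer⇒simulates T₁ᶠ)))

  ctx-bisim : ∀ {p} {R : CRel p} → IsCondBisim R → IsCondBisim (Ctx R)
  ctx-bisim {R = R} (T , Tᶠ) =
    simulates⇒transfer (ctx-simulates (transfer⇒simulates T)) ,
    simulates⇒transfer
      (simulates-resp (flip-ctx⁺ {R = R}) (flip-ctx⁻ {R = R}) (ctx-simulates (transfer⇒simulates Tᶠ)))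

  CtxClosed : ∀ {p} → CRel p → Set (o ⊔ h ⊔ p)
  CtxClosed R = ∀ {J K} (a b : Hom 𝟎 J) (𝒞 : Cond J) (d : Hom J K) →
                R a b 𝒞 → R (a ⨾ d) (b ⨾ d) (𝒞 ↓ d)

  -- A simulation answers environment steps: view the environment step of a
  -- along d as the context step (id , ℛ↓c) fired in environment d.
  simulates⇒envTransfer : ∀ {p} {R : CRel p} → Simulates R → EnvTransfer R
  simulates⇒envTransfer sim a b 𝒞 r d d⊨𝒞 a' a-env =
    let (𝒜 , a-step , d⊨𝒜) = env⇒ctx (subst (λ a₀ → EStep a₀ d a') (sym (idʳ a)) a-env)
        match b' ℬ 𝒞' b-step r' d⊨𝒞' d⊨ℬ = sim a b 𝒞 r id 𝒜 a' a-step d d⊨𝒜 (shift-id 𝒞 d d⊨𝒞)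
    in b' , subst (λ b₀ → EStep b₀ d b') (idʳ b) (ctx⇒env {𝒜 = ℬ} b-step d⊨ℬ) , 𝒞' , d⊨𝒞' , r'

  -- Conversely a context-closed environment bisimulation simulates: a context
  -- step (f , 𝒜) in environment x is an environment step of a ⨾ f, and
  -- (a ⨾ f , b ⨾ f , 𝒞↓f) is again related.
  envTransfer⇒simulates : ∀ {p} {R : CRel p} → EnvTransfer R → CtxClosed R → Simulates R
  envTransfer⇒simulates env ctx a b 𝒞 r f 𝒜 a' a-step x x⊨𝒜 x⊨𝒞↓f =
    let (b' , b-env , 𝒞' , x⊨𝒞' , r') =
          env (a ⨾ f) (b ⨾ f) (𝒞 ↓ f) (ctx a b 𝒞 f r) x x⊨𝒞↓f a' (ctx⇒env {𝒜 = 𝒜} a-step x⊨𝒜)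
        (ℬ , b-step , x⊨ℬ) = env⇒ctx b-env
    in match b' ℬ 𝒞' b-step r' x⊨𝒞' x⊨ℬ

  condBisim⇒envBisim : ∀ {p} {R : CRel p} → IsCondBisim R → IsEnvBisim R
  condBisim⇒envBisim (T , Tᶠ) =
    simulates⇒envTransfer (transfer⇒simulates T) , simulates⇒envTransfer (transfer⇒simulates Tᶠ)

  envBisim⇒condBisim : ∀ {p} {R : CRel p} → IsEnvBisim R → CtxClosed R → IsCondBisim R
  envBisim⇒condBisim (E , Eᶠ) ctx =
    simulates⇒transfer (envTransfer⇒simulates E ctx) ,
    simulates⇒transfer (envTransfer⇒simulates Eᶠ λ a b 𝒞 d → ctx b a 𝒞 d)

  ≃C-envBisim : IsEnvBisim ≃C
  ≃C-envBisim = forth , back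
    where
    forth : EnvTransfer ≃C
    forth a b 𝒞 (R , R-bisim , r) d d⊨𝒞 a' a-env =
      let (b' , b-env , 𝒞' , d⊨𝒞' , r') =
            proj₁ (condBisim⇒envBisim R-bisim) a b 𝒞 r d d⊨𝒞 a' a-env
      in b' , b-env , 𝒞' , d⊨𝒞' , (R , R-bisim , r')
    back : EnvTransfer (Flip ≃C)
    back a b 𝒞 (R , R-bisim , r) d d⊨𝒞 a' a-env =
      let (b' , b-env , 𝒞' , d⊨𝒞' , r') =
            proj₂ (condBisim⇒envBisim R-bisim) a b 𝒞 r d d⊨𝒞 a' a-env
      in b' , b-env , 𝒞' , d⊨𝒞' , (R , R-bisim , r')

  ≃C-congruence : IsCondCongruence ≃C
  ≃C-congruence = record
    { refl  = λ a 𝒞 → Identity , identity-bisim , lift refl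
    ; sym   = λ { _ _ _ (R , R-bisim , r) → Flip R , flip-bisim R-bisim , r }
    ; trans = λ { _ b _ 𝒞 (R₁ , R₁-bisim , r₁) (R₂ , R₂-bisim , r₂) →
                  Comp R₁ R₂ , comp-bisim R₁-bisim R₂-bisim ,
                  (b , 𝒞 , 𝒞 , r₁ , r₂ , (λ _ p → p) , (λ _ p → p)) }
    ; ctx   = λ { a b 𝒞 d (R , R-bisim , r) →
                  Ctx R , ctx-bisim R-bisim , (_ , d , a , b , 𝒞 , r , refl , refl , λ _ p → p) }
    }

  -- Every environment congruence is a conditional bisimulation, hence below ≃C.
  ≃C-largest : ∀ (R : CRel (o ⊔ h)) → IsEnvBisim R → IsCondCongruence R → R ⊆ ≃C
  ≃C-largest R R-env R-cong a b 𝒞 r =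
    R , envBisim⇒condBisim R-env (IsCondCongruence.ctx R-cong) , r

theorem6p4 : ∀ {o h} (𝐂 : Cat o h) (κ : RepSquares 𝐂) (𝟎 : Cat.Obj 𝐂)
               (𝒮 : Reactive.System 𝐂 κ 𝟎) →
             Reactive.Steps.IsLargestEnvCongruence 𝐂 κ 𝟎 𝒮
               (Reactive.Steps.≃C 𝐂 κ 𝟎 𝒮)
theorem6p4 𝐂 κ 𝟎 𝒮 = (≃C-envBisim , ≃C-congruence) , ≃C-largest
  where open CondBisimulation 𝐂 κ 𝟎 𝒮
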